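{- Let $X$ be a finite set, $f:2^X\to\mathbb{R}_{\ge0}$ a monotone submodular set function, and $c:2^X\to\mathbb{R}_{\ge0}$ a cost function with $c(T)=\sum_{x\in T}c(\{x\})$ for each $T\subseteq X$, where $c(\{x\})>0$ for all $x\in X$. For a set $T\subseteq X$ and an integer $1\le y\le |T|$, let $T_y$ denote a subset of $T$ with $|T_y|=y$ such that $\frac{f(T_y)}{c(T_y)}$ is maximum among such subsets. Then $\frac{f(T)}{c(T)}\le\frac{f(T_y)}{c(T_y)}$ for every integer $1\le y\le|T|$. -}

module Defs where

open import Level using (Level; suc; _⊔_)
open import Data.Nat using (ℕ; zero) renaming (suc to sucℕ)
open import Data.Bool using (true; false)
open import Data.Vec using ([]; _∷_)
open import Data.Fin as Fin using (Fin)
open import Data.Fin.Subset using (Subset; _⊆_; _∪_; _∩_; ⁅_⁆; _∈_)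
open import Data.Product using (_×_; Σ)
open import Data.Sum using (_⊎_)
open import Relation.Nullary using (¬_)
open import Algebra.Bundles using (CommutativeRing)

record OrderedField (c ℓ₁ ℓ₂ : Level) : Set (suc (c ⊔ ℓ₁ ⊔ ℓ₂)) where
  field
    cring : CommutativeRing c ℓ₁
  open CommutativeRing cring public
  field
    _≤_        : Carrier → Carrier → Set ℓ₂
    ≤-refl     : ∀ {x y} → x ≈ y → x ≤ y
    ≤-trans    : ∀ {x y z} → x ≤ y → y ≤ z → x ≤ z
    ≤-antisym  : ∀ {x y} → x ≤ y → y ≤ x → x ≈ y
    ≤-total    : ∀ x y → (x ≤ y) ⊎ (y ≤ x)
    ≤-resp-≈   : ∀ {x x' y y'} → x ≈ x' → y ≈ y' → x ≤ y → x' ≤ y'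
    +-mono-≤   : ∀ {x y} z → x ≤ y → (x + z) ≤ (y + z)
    *-nonneg   : ∀ {x y} → 0# ≤ x → 0# ≤ y → 0# ≤ (x * y)
    0≉1        : ¬ (0# ≈ 1#)
    inverse    : ∀ x → ¬ (x ≈ 0#) → Σ Carrier (λ y → (x * y) ≈ 1#)

  _<_ : Carrier → Carrier → Set (ℓ₁ ⊔ ℓ₂)
  x < y = (x ≤ y) × ¬ (x ≈ y)

module _ {c ℓ₁ ℓ₂} (F : OrderedField c ℓ₁ ℓ₂) where
  open OrderedField F

  sumOver : ∀ {n} → (Fin n → Carrier) → Subset n → Carrier
  sumOver {zero}   g []          = 0#
  sumOver {sucℕ n} g (true  ∷ T) = g Fin.zero + sumOver (λ i → g (Fin.suc i)) T
  sumOver {sucℕ n} g (false ∷ T) = sumOver (λ i → g (Fin.suc i)) T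

  Monotone : ∀ {n} → (Subset n → Carrier) → Set ℓ₂
  Monotone {n} f = ∀ {S T : Subset n} → S ⊆ T → f S ≤ f T

  Submodular : ∀ {n} → (Subset n → Carrier) → Set ℓ₂
  Submodular {n} f = ∀ (S T : Subset n) → (f (S ∪ T) + f (S ∩ T)) ≤ (f S + f T)

  NonNeg : ∀ {n} → (Subset n → Carrier) → Set ℓ₂
  NonNeg {n} f = ∀ (S : Subset n) → 0# ≤ f S

  Additive : ∀ {n} → (Subset n → Carrier) → Set ℓ₁
  Additive {n} c = ∀ (T : Subset n) → c T ≈ sumOver (λ x → c ⁅ x ⁆) T

module Submission where

-- Grow S from size y up to T, one element at a time. If |S| = k + 2 and every
-- S - x (x ∈ S) has ratio at most r = f(Ty)/c(Ty), sum over x ∈ S: submodularity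
-- gives Σ f(S - x) ≥ (|S| - 1) f(S) + f(∅) ≥ (k + 1) f(S), additivity gives
-- Σ c(S - x) = (k + 1) c(S), so (k + 1) f(S) ≤ r (k + 1) c(S).

open import Defs
open import Level using (Level)
open import Data.Nat using (ℕ) renaming (_≤_ to _≤ℕ_)
open import Data.Fin using (Fin)
open import Data.Fin.Subset using (Subset; _⊆_; ⁅_⁆; ∣_∣)
open import Relation.Binary.PropositionalEquality using (_≡_)

open import Data.Nat as ℕ using (zero; suc; s≤s; z≤n; _∸_)
open import Data.Fin using (zero; suc)
open import Data.Nat.Properties using (+-suc; m∸n+n≡m; suc-injective)
open import Data.Bool using (true; false)
open import Data.Vec using ([]; _∷_; here; there)
open import Data.Fin.Subset using (_∈_; _─_; _-_; ⊥)
open import Data.Fin.Subset.Properties using (p─⊥≡p; p─q⊆p; ∪-identityʳ; ∩-zeroʳ)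
open import Data.Sum using (inj₁; inj₂)
open import Function using (_∘_)
open import Relation.Binary.Bundles using (Preorder)
open import Relation.Binary.PropositionalEquality as ≡ using (cong; subst₂)
import Relation.Binary.Reasoning.Preorder as PreorderReasoning
import Relation.Binary.Reasoning.Setoid as SetoidReasoning

x∈p⇒suc∣p-x∣≡∣p∣ : ∀ {n} {x : Fin n} {p : Subset n} → x ∈ p → suc ∣ p - x ∣ ≡ ∣ p ∣
x∈p⇒suc∣p-x∣≡∣p∣ {p = true  ∷ p} here        = cong (suc ∘ ∣_∣) (p─⊥≡p p)
x∈p⇒suc∣p-x∣≡∣p∣ {p = true  ∷ p} (there x∈p) = cong suc (x∈p⇒suc∣p-x∣≡∣p∣ x∈p)
x∈p⇒suc∣p-x∣≡∣p∣ {p = false ∷ p} (there x∈p) = x∈p⇒suc∣p-x∣≡∣p∣ x∈p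

module _ {c ℓ₁ ℓ₂} (F : OrderedField c ℓ₁ ℓ₂) where

  open OrderedField F hiding (zero; _-_) renaming (_≤_ to infix 4 _≤_)
  open import Algebra.Properties.Semiring.Mult semiring using (_×_; ×-congʳ; ×-assoc-*; ×-comm-*)
  open import Algebra.Properties.CommutativeMonoid.Mult +-commutativeMonoid using (×-distrib-+)
  open import Algebra.Properties.Group +-group using (∙-cancelʳ; //-rightDividesˡ; //-rightDividesʳ)
  open import Algebra.Properties.CommutativeSemigroup +-commutativeSemigroup using (interchange)
  open import Algebra.Solver.CommutativeMonoid +-commutativeMonoid using (solve; _⊜_; _⊕_)

  ≤-preorder : Preorder c ℓ₁ ℓ₂
  ≤-preorder = record
    { isPreorder = record { isEquivalence = isEquivalence ; reflexive = ≤-refl ; trans = ≤-trans } }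

  module ≤-Reasoning = PreorderReasoning ≤-preorder
  module ≈-Reasoning = SetoidReasoning setoid

  +-monoʳ-≤ : ∀ {x y} z → x ≤ y → z + x ≤ z + y
  +-monoʳ-≤ {x} {y} z x≤y = ≤-resp-≈ (+-comm x z) (+-comm y z) (+-mono-≤ z x≤y)

  +-mono₂-≤ : ∀ {x y u v} → x ≤ y → u ≤ v → x + u ≤ y + v
  +-mono₂-≤ {y = y} {u} x≤y u≤v = ≤-trans (+-mono-≤ u x≤y) (+-monoʳ-≤ y u≤v)

  +-cancelʳ-≤ : ∀ {x y} z → x + z ≤ y + z → x ≤ y
  +-cancelʳ-≤ {x} {y} z x+z≤y+z =
    ≤-resp-≈ (//-rightDividesʳ z x) (//-rightDividesʳ z y) (+-mono-≤ (- z) x+z≤y+z)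

  x≤x+y : ∀ {x y} → 0# ≤ y → x ≤ x + y
  x≤x+y {x} 0≤y = ≤-resp-≈ (+-identityʳ x) refl (+-monoʳ-≤ x 0≤y)

  *-monoˡ-≤-nonNeg : ∀ {x y z} → 0# ≤ z → x ≤ y → x * z ≤ y * z
  *-monoˡ-≤-nonNeg {x} {y} {z} 0≤z x≤y = begin
    x * z                  ≈⟨ +-identityˡ (x * z) ⟨
    0# + x * z             ≲⟨ +-mono-≤ (x * z) (*-nonneg 0≤y-x 0≤z) ⟩
    (y + - x) * z + x * z  ≈⟨ distribʳ z (y + - x) x ⟨
    (y + - x + x) * z      ≈⟨ *-congʳ (//-rightDividesˡ x y) ⟩
    y * z                  ∎
    where
    open ≤-Reasoning
    0≤y-x : 0# ≤ y + - x
    0≤y-x = ≤-resp-≈ (-‿inverseʳ x) refl (+-mono-≤ (- x) x≤y)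

  ×-monoʳ-≤ : ∀ n {x y} → x ≤ y → n × x ≤ n × y
  ×-monoʳ-≤ zero    x≤y = ≤-refl refl
  ×-monoʳ-≤ (suc n) x≤y = +-mono₂-≤ x≤y (×-monoʳ-≤ n x≤y)

  ×-cancelˡ-≤ : ∀ n {x y} → suc n × x ≤ suc n × y → x ≤ y
  ×-cancelˡ-≤ n {x} {y} n+1x≤n+1y with ≤-total x y
  ... | inj₁ x≤y = x≤y
  ... | inj₂ y≤x = +-cancelʳ-≤ (n × x) (begin
    x + n × x  ≲⟨ n+1x≤n+1y ⟩
    y + n × y  ≲⟨ +-monoʳ-≤ y (×-monoʳ-≤ n y≤x) ⟩
    y + n × x  ∎)
    where open ≤-Reasoning

  sumOver-cong : ∀ {n} {g h : Fin n → Carrier} (T : Subset n) →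
                 (∀ i → g i ≈ h i) → sumOver F g T ≈ sumOver F h T
  sumOver-cong []          g≈h = refl
  sumOver-cong (true  ∷ T) g≈h = +-cong (g≈h zero) (sumOver-cong T (g≈h ∘ suc))
  sumOver-cong (false ∷ T) g≈h = sumOver-cong T (g≈h ∘ suc)

  sumOver-mono : ∀ {n} {g h : Fin n → Carrier} (T : Subset n) →
                 (∀ i → i ∈ T → g i ≤ h i) → sumOver F g T ≤ sumOver F h T
  sumOver-mono []          g≤h = ≤-refl refl
  sumOver-mono (true  ∷ T) g≤h =
    +-mono₂-≤ (g≤h zero here) (sumOver-mono T (λ i i∈T → g≤h (suc i) (there i∈T)))
  sumOver-mono (false ∷ T) g≤h = sumOver-mono T (λ i i∈T → g≤h (suc i) (there i∈T))

  sumOver-+ : ∀ {n} (g h : Fin n → Carrier) (T : Subset n) →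
              sumOver F (λ i → g i + h i) T ≈ sumOver F g T + sumOver F h T
  sumOver-+ g h []          = sym (+-identityʳ 0#)
  sumOver-+ g h (true  ∷ T) =
    trans (+-congˡ (sumOver-+ (g ∘ suc) (h ∘ suc) T)) (interchange _ _ _ _)
  sumOver-+ g h (false ∷ T) = sumOver-+ (g ∘ suc) (h ∘ suc) T

  sumOver-const : ∀ {n} (a : Carrier) (T : Subset n) → sumOver F (λ _ → a) T ≈ ∣ T ∣ × a
  sumOver-const a []          = refl
  sumOver-const a (true  ∷ T) = +-congˡ (sumOver-const a T)
  sumOver-const a (false ∷ T) = sumOver-const a T

  sumOver-*ʳ : ∀ {n} (g : Fin n → Carrier) k (T : Subset n) →
               sumOver F (λ i → g i * k) T ≈ sumOver F g T * k
  sumOver-*ʳ g k []          = sym (zeroˡ k)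
  sumOver-*ʳ g k (true  ∷ T) = trans (+-congˡ (sumOver-*ʳ (g ∘ suc) k T)) (sym (distribʳ k _ _))
  sumOver-*ʳ g k (false ∷ T) = sumOver-*ʳ (g ∘ suc) k T

  sumOver-*ˡ : ∀ {n} (g : Fin n → Carrier) k (T : Subset n) →
               sumOver F (λ i → k * g i) T ≈ k * sumOver F g T
  sumOver-*ˡ g k T =
    trans (sumOver-cong T (λ i → *-comm k (g i))) (trans (sumOver-*ʳ g k T) (*-comm _ k))

  sumOver-removals : ∀ {n} (w : Fin n → Carrier) (T : Subset n) →
    sumOver F (λ x → sumOver F w (T - x)) T + sumOver F w T ≈ ∣ T ∣ × sumOver F w T
  sumOver-removals w []          = +-identityʳ 0#
  sumOver-removals w (false ∷ T) = sumOver-removals (w ∘ suc) T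
  sumOver-removals w (true  ∷ T) = begin
    (sumOver F (w ∘ suc) (T ─ ⊥) + sumOver F (λ i → w zero + sumOver F (w ∘ suc) (T - i)) T)
      + (w zero + W)
      ≈⟨ +-congʳ (+-cong (reflexive (cong (sumOver F (w ∘ suc)) (p─⊥≡p T)))
                         (trans (sumOver-+ _ _ T) (+-congʳ (sumOver-const (w zero) T)))) ⟩
    (W + (t × w zero + S)) + (w zero + W)
      ≈⟨ solve 4 (λ W a S w₀ → (W ⊕ (a ⊕ S)) ⊕ (w₀ ⊕ W) ⊜ (w₀ ⊕ W) ⊕ (a ⊕ (S ⊕ W)))
               refl W (t × w zero) S (w zero) ⟩
    (w zero + W) + (t × w zero + (S + W))
      ≈⟨ +-congˡ (+-congˡ (sumOver-removals (w ∘ suc) T)) ⟩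
    (w zero + W) + (t × w zero + t × W)
      ≈⟨ +-congˡ (×-distrib-+ (w zero) W t) ⟨
    (w zero + W) + t × (w zero + W)
      ∎
    where
    open ≈-Reasoning
    W = sumOver F (w ∘ suc) T
    S = sumOver F (λ i → sumOver F (w ∘ suc) (T - i)) T
    t = ∣ T ∣

  submodular-removals : ∀ {n} (g : Subset n → Carrier) → Submodular F g → (T : Subset n) →
    ∣ T ∣ × g T + g ⊥ ≤ sumOver F (λ x → g (T - x)) T + g T
  submodular-removals g g-sub []          = ≤-refl refl
  submodular-removals g g-sub (false ∷ T) =
    submodular-removals (g ∘ (false ∷_)) (λ S U → g-sub (false ∷ S) (false ∷ U)) T
  submodular-removals g g-sub (true  ∷ T) = +-cancelʳ-≤ q (begin
    ((a + t × a) + b) + q  ≈⟨ solve 4 (λ a ta b q → ((a ⊕ ta) ⊕ b) ⊕ q ⊜ (ta ⊕ q) ⊕ (a ⊕ b))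
                                       refl a (t × a) b q ⟩
    (t × a + q) + (a + b)  ≲⟨ +-mono₂-≤ ih split ⟩
    (s + a) + (p + q)      ≈⟨ solve 4 (λ s a p q → (s ⊕ a) ⊕ (p ⊕ q) ⊜ ((p ⊕ s) ⊕ a) ⊕ q)
                                       refl s a p q ⟩
    ((p + s) + a) + q      ≡⟨ cong (λ P → ((g (false ∷ P) + s) + a) + q) (p─⊥≡p T) ⟨
    ((g (false ∷ (T ─ ⊥)) + s) + a) + q ∎)
    where
    open ≤-Reasoning
    a = g (true ∷ T)
    b = g (false ∷ ⊥)
    p = g (false ∷ T)
    q = g (true ∷ ⊥)
    s = sumOver F (λ i → g (true ∷ (T - i))) T
    t = ∣ T ∣
    ih : t × a + q ≤ s + a
    ih = submodular-removals (g ∘ (true ∷_)) (λ S U → g-sub (true ∷ S) (true ∷ U)) T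
    split : a + b ≤ p + q
    split = subst₂ (λ U V → g (true ∷ U) + g (false ∷ V) ≤ p + q)
                   (∪-identityʳ T) (∩-zeroʳ T) (g-sub (false ∷ T) (true ∷ ⊥))

  submodular-removals-lower-bound : ∀ {n k} (g : Subset n → Carrier) → NonNeg F g → Submodular F g →
    (T : Subset n) → ∣ T ∣ ≡ suc k → k × g T ≤ sumOver F (λ x → g (T - x)) T
  submodular-removals-lower-bound {k = k} g g-nonNeg g-sub T ∣T∣≡k+1 =
    +-cancelʳ-≤ (g T) (begin
      k × g T + g T          ≲⟨ +-mono-≤ (g T) (x≤x+y (g-nonNeg ⊥)) ⟩
      (k × g T + g ⊥) + g T  ≈⟨ solve 3 (λ kg g⊥ g → (kg ⊕ g⊥) ⊕ g ⊜ (g ⊕ kg) ⊕ g⊥)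
                                         refl (k × g T) (g ⊥) (g T) ⟩
      suc k × g T + g ⊥      ≡⟨ cong (λ m → m × g T + g ⊥) ∣T∣≡k+1 ⟨
      ∣ T ∣ × g T + g ⊥      ≲⟨ submodular-removals g g-sub T ⟩
      sumOver F (λ x → g (T - x)) T + g T ∎)
    where open ≤-Reasoning

  additive-removals : ∀ {n k} (cost : Subset n → Carrier) → Additive F cost →
    (T : Subset n) → ∣ T ∣ ≡ suc k → sumOver F (λ x → cost (T - x)) T ≈ k × cost T
  additive-removals {n} {k} cost cost-additive T ∣T∣≡k+1 = ∙-cancelʳ (cost T) _ _ (begin
    sumOver F (λ x → cost (T - x)) T + cost T
      ≈⟨ +-cong (sumOver-cong T (λ x → cost-additive (T - x))) (cost-additive T) ⟩
    sumOver F (λ x → sumOver F w (T - x)) T + sumOver F w T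
      ≈⟨ sumOver-removals w T ⟩
    ∣ T ∣ × sumOver F w T
      ≈⟨ ×-congʳ ∣ T ∣ (cost-additive T) ⟨
    ∣ T ∣ × cost T
      ≡⟨ cong (_× cost T) ∣T∣≡k+1 ⟩
    cost T + k × cost T
      ≈⟨ +-comm (cost T) (k × cost T) ⟩
    k × cost T + cost T ∎)
    where
    open ≈-Reasoning
    w : Fin n → Carrier
    w x = cost ⁅ x ⁆

  module RatioBound {n} (f cost : Subset n → Carrier)
    (f-nonNeg : NonNeg F f) (f-submodular : Submodular F f) (cost-additive : Additive F cost)
    (p q : Carrier) (0≤q : 0# ≤ q) where

    -- f S / cost S ≤ p / q, cleared of denominators
    Bounded : Subset n → Set ℓ₂
    Bounded S = f S * q ≤ p * cost S

    bounded-from-removals : ∀ {k} (T : Subset n) → ∣ T ∣ ≡ suc (suc k) →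
                            (∀ {x} → x ∈ T → Bounded (T - x)) → Bounded T
    bounded-from-removals {k} T ∣T∣≡k+2 removals-bounded = ×-cancelˡ-≤ k (begin
      suc k × (f T * q)                     ≈⟨ ×-assoc-* (suc k) (f T) q ⟨
      (suc k × f T) * q                     ≲⟨ *-monoˡ-≤-nonNeg 0≤q f-removals ⟩
      sumOver F (λ x → f (T - x)) T * q     ≈⟨ sumOver-*ʳ (λ x → f (T - x)) q T ⟨
      sumOver F (λ x → f (T - x) * q) T     ≲⟨ sumOver-mono T (λ _ x∈T → removals-bounded x∈T) ⟩
      sumOver F (λ x → p * cost (T - x)) T  ≈⟨ sumOver-*ˡ (λ x → cost (T - x)) p T ⟩
      p * sumOver F (λ x → cost (T - x)) T  ≈⟨ *-congˡ cost-removals ⟩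
      p * (suc k × cost T)                  ≈⟨ ×-comm-* (suc k) p (cost T) ⟩
      suc k × (p * cost T)                  ∎)
      where
      open ≤-Reasoning
      f-removals : suc k × f T ≤ sumOver F (λ x → f (T - x)) T
      f-removals = submodular-removals-lower-bound f f-nonNeg f-submodular T ∣T∣≡k+2
      cost-removals : sumOver F (λ x → cost (T - x)) T ≈ suc k × cost T
      cost-removals = additive-removals cost cost-additive T ∣T∣≡k+2

    bounded-upward : ∀ {y} (T₀ : Subset n) →
                     (∀ S → S ⊆ T₀ → ∣ S ∣ ≡ suc y → Bounded S) →
                     ∀ d S → S ⊆ T₀ → ∣ S ∣ ≡ d ℕ.+ suc y → Bounded S
    bounded-upward T₀ bounded-at-y zero    S S⊆T₀ ∣S∣≡y = bounded-at-y S S⊆T₀ ∣S∣≡y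
    bounded-upward {y} T₀ bounded-at-y (suc d) S S⊆T₀ ∣S∣≡d+1+y =
      bounded-from-removals S (≡.trans ∣S∣≡d+1+y (cong suc (+-suc d y))) λ {x} x∈S →
        bounded-upward T₀ bounded-at-y d (S - x)
          (λ z∈S-x → S⊆T₀ (p─q⊆p S ⁅ x ⁆ z∈S-x))
          (suc-injective (≡.trans (x∈p⇒suc∣p-x∣≡∣p∣ x∈S) ∣S∣≡d+1+y))

lemma4 : ∀ {c ℓ₁ ℓ₂ : Level} (F : OrderedField c ℓ₁ ℓ₂) (n : ℕ)
         (f cost : Subset n → OrderedField.Carrier F) →
         NonNeg F f → Monotone F f → Submodular F f →
         NonNeg F cost → Additive F cost →
         (∀ (x : Fin n) → OrderedField._<_ F (OrderedField.0# F) (cost ⁅ x ⁆)) →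
         ∀ (T : Subset n) (y : ℕ) → 1 ≤ℕ y → y ≤ℕ ∣ T ∣ →
         ∀ (Ty : Subset n) → Ty ⊆ T → ∣ Ty ∣ ≡ y →
         (∀ (S : Subset n) → S ⊆ T → ∣ S ∣ ≡ y →
            OrderedField._≤_ F (OrderedField._*_ F (f S) (cost Ty))
                               (OrderedField._*_ F (f Ty) (cost S))) →
         OrderedField._≤_ F (OrderedField._*_ F (f T) (cost Ty))
                            (OrderedField._*_ F (f Ty) (cost T))
lemma4 F n f cost f-nonNeg _ f-submodular cost-nonNeg cost-additive _
       T (suc y) (s≤s z≤n) y≤∣T∣ Ty _ _ Ty-maximal =
  bounded-upward T Ty-maximal (∣ T ∣ ∸ suc y) T (λ x∈T → x∈T) (≡.sym (m∸n+n≡m y≤∣T∣))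
  where open RatioBound F f cost f-nonNeg f-submodular cost-additive (f Ty) (cost Ty) (cost-nonNeg Ty)
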